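{- Let $h$ and $k$ be integers with $k\ge 5$ and $3\le h\le k-1$. Let $A=\{a_0,a_1,\ldots,a_{k-1}\}$ be a set of $k$ nonnegative integers with $0=a_0<a_1<\cdots<a_{k-1}$, and let $A_h=\{a_0,a_1,\ldots,a_h\}$. If $\left|h^{\wedge}_{\pm}A_h\right|\ge h(h+1)+1+t$ for some integer $t\ge 0$, then $$\left|h^{\wedge}_{\pm}A\right|\ge 2hk-h(h+1)+1+t.$$
   Context: For a positive integer $h$ and a finite set of integers $A=\{a_1,\ldots,a_k\}$ (distinct elements), the restricted $h$-fold signed sumset is $h^{\wedge}_{\pm}A=\left\{\sum_{i=1}^k\lambda_i a_i:\lambda_i\in\{ -1,0,1\},\ \sum_{i=1}^k|\lambda_i|=h\right\}$. -}

module Defs where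

open import Data.Nat using (ℕ; zero; suc; _≤_)
open import Data.Integer as ℤ using (ℤ; +_; -_; _+_)
open import Data.Fin using (Fin; zero; suc; inject≤)
open import Data.List using (List; []; _∷_; map; concatMap; filter; length; deduplicate)
open import Data.Nat.Properties using (_≟_)
import Data.Integer.Properties as ℤP

data Sign : Set where
  neg zer pos : Sign

∣_∣ˢ : Sign → ℕ
∣ neg ∣ˢ = 1
∣ zer ∣ˢ = 0
∣ pos ∣ˢ = 1

act : Sign → ℤ → ℤ
act neg x = - x
act zer x = + 0
act pos x = x

signVecs : (n : ℕ) → List (Fin n → Sign)
signVecs zero = (λ ()) ∷ []
signVecs (suc n) =
  concatMap (λ v → map (λ s → cons s v) (neg ∷ zer ∷ pos ∷ []))
            (signVecs n)
  where
  cons : Sign → (Fin n → Sign) → Fin (suc n) → Sign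
  cons s v zero = s
  cons s v (suc i) = v i

weight : (n : ℕ) → (Fin n → Sign) → ℕ
weight zero l = 0
weight (suc n) l = ∣ l zero ∣ˢ Data.Nat.+ weight n (λ i → l (suc i))

signedSum : (n : ℕ) → (Fin n → ℤ) → (Fin n → Sign) → ℤ
signedSum zero a l = + 0
signedSum (suc n) a l = act (l zero) (a zero) + signedSum n (λ i → a (suc i)) (λ i → l (suc i))

-- h^∧_± A for A = {a_0,…,a_{n-1}} (as a list, possibly with repetitions)
restrictedSignedSumList : (h n : ℕ) → (Fin n → ℤ) → List ℤ
restrictedSignedSumList h n a =
  map (signedSum n a) (filter (λ l → weight n l ≟ h) (signVecs n))

card-hSignedSumset : (h n : ℕ) → (Fin n → ℤ) → ℕ
card-hSignedSumset h n a = length (deduplicate ℤ._≟_ (restrictedSignedSumList h n a))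

module Submission where

-- Let b₀ < b₁ < ⋯ and let M be the largest element of h^∧_±{b₀,…,b_{n−1}}, namely the sum of the
-- h largest of these elements, so that this sumset lies in [−M, M]. Omitting in turn one of the h
-- largest elements of {b₀,…,b_{n−1}} gives h distinct (h−1)-fold sums y ≥ M − b_{n−1}; hence for
-- a new element c = b_n > b_{n−1} the h sums c + y exceed M and their negatives lie below −M.
-- Each element added to A_h therefore enlarges the signed sumset by at least 2h, and passing from
-- A_h to A adds 2h(k − h − 1) elements.

open import Defs
open import Algebra.Bundles using (AbelianGroup)
open import Data.Empty using (⊥-elim)
open import Data.Fin as F using (Fin; zero; suc; toℕ; inject≤; fromℕ; fromℕ<)
import Data.Fin.Properties as FP
open import Data.Integer as ℤ using (ℤ; +_; -_; +≤+; +<+)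
import Data.Integer.Properties as ℤP
open import Data.List using (List; []; _∷_; _++_; map; length; deduplicate)
open import Data.List.Membership.Propositional using (_∈_)
import Data.List.Membership.Propositional.Properties as ∈P
import Data.List.Properties as ListP
open import Data.List.Relation.Unary.All as All using (All; []; _∷_)
import Data.List.Relation.Unary.All.Properties as AllP
open import Data.List.Relation.Unary.AllPairs using ([]; _∷_)
import Data.List.Relation.Unary.AllPairs.Properties as AllPairsP
open import Data.List.Relation.Unary.Any using (here; there)
open import Data.List.Relation.Unary.Unique.Propositional using (Unique)
import Data.List.Relation.Unary.Unique.Propositional.Properties as UniqueP
open import Data.List.Relation.Unary.Unique.DecPropositional.Properties using (deduplicate-!)
open import Data.Nat as ℕ using (ℕ; zero; suc; _+_; _*_; _∸_; _≤_; _<_; z≤n; s≤s)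
import Data.Nat.Properties as ℕP
open import Data.Nat.Tactic.RingSolver using (solve-∀)
open import Data.Product using (∃; _×_; _,_; proj₁; proj₂)
open import Data.Sum using (_⊎_; inj₁; inj₂; [_,_])
open import Data.Vec.Functional using (init; last)
open import Function using (_∘_; id)
open import Relation.Binary.PropositionalEquality
  using (_≡_; _≢_; _≗_; refl; sym; trans; cong; cong₂; subst; subst₂; ≢-sym; module ≡-Reasoning)
open import Relation.Nullary using (yes; no)

open import Algebra.Properties.Group (AbelianGroup.group ℤP.+-0-abelianGroup) using (∙-cancelʳ)

private
  variable
    A : Set
    m n w : ℕ
    x : ℤ
    P R : ℤ → Set

signedSum-cong : ∀ n {a a' : Fin n → ℤ} {l l' : Fin n → Sign} →
                 a ≗ a' → l ≗ l' → signedSum n a l ≡ signedSum n a' l'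
signedSum-cong zero    a≗a' l≗l' = refl
signedSum-cong (suc n) a≗a' l≗l' =
  cong₂ ℤ._+_ (cong₂ act (l≗l' zero) (a≗a' zero)) (signedSum-cong n (a≗a' ∘ suc) (l≗l' ∘ suc))

weight-cong : ∀ n {l l' : Fin n → Sign} → l ≗ l' → weight n l ≡ weight n l'
weight-cong zero    l≗l' = refl
weight-cong (suc n) l≗l' = cong₂ _+_ (cong ∣_∣ˢ (l≗l' zero)) (weight-cong n (l≗l' ∘ suc))

signedSum-init-last : ∀ n (a : Fin (suc n) → ℤ) (l : Fin (suc n) → Sign) →
  signedSum (suc n) a l ≡ signedSum n (init a) (init l) ℤ.+ act (last l) (last a)
signedSum-init-last zero    a l = ℤP.+-comm (act (l zero) (a zero)) (+ 0)
signedSum-init-last (suc n) a l =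
  trans (cong (ℤ._+_ (act (l zero) (a zero))) (signedSum-init-last n (a ∘ suc) (l ∘ suc)))
        (sym (ℤP.+-assoc (act (l zero) (a zero)) _ _))

weight-init-last : ∀ n (l : Fin (suc n) → Sign) →
  weight (suc n) l ≡ weight n (init l) + ∣ last l ∣ˢ
weight-init-last zero    l = ℕP.+-comm ∣ l zero ∣ˢ 0
weight-init-last (suc n) l =
  trans (cong (_+_ ∣ l zero ∣ˢ) (weight-init-last n (l ∘ suc))) (sym (ℕP.+-assoc ∣ l zero ∣ˢ _ _))

_∷ʳ_ : (Fin n → A) → A → Fin (suc n) → A
_∷ʳ_ {n = zero}  l s zero    = s
_∷ʳ_ {n = suc n} l s zero    = l zero
_∷ʳ_ {n = suc n} l s (suc i) = ((l ∘ suc) ∷ʳ s) i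

init-∷ʳ : (l : Fin n → A) (s : A) → init (l ∷ʳ s) ≗ l
init-∷ʳ {n = suc n} l s zero    = refl
init-∷ʳ {n = suc n} l s (suc i) = init-∷ʳ (l ∘ suc) s i

last-∷ʳ : (l : Fin n → A) (s : A) → last (l ∷ʳ s) ≡ s
last-∷ʳ {n = zero}  l s = refl
last-∷ʳ {n = suc n} l s = last-∷ʳ (l ∘ suc) s

IsSignedSum : (n : ℕ) → (Fin n → ℤ) → ℕ → ℤ → Set
IsSignedSum n a w x = ∃ λ l → weight n l ≡ w × signedSum n a l ≡ x

IsSignedSum-cong : ∀ n {a a' : Fin n → ℤ} → a ≗ a' → IsSignedSum n a w x → IsSignedSum n a' w x
IsSignedSum-cong n a≗a' (l , wl , sl) = l , wl , trans (sym (signedSum-cong n a≗a' (λ _ → refl))) sl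

signVecs-complete : ∀ n (l : Fin n → Sign) → ∃ λ l' → l' ∈ signVecs n × l' ≗ l
signVecs-complete zero    l = _ , here refl , λ ()
signVecs-complete (suc n) l with signVecs-complete n (l ∘ suc) | l zero in l₀
... | l' , l'∈ , l'≗ | neg = _ , ∈P.∈-concat⁺′ (here refl) (∈P.∈-map⁺ _ l'∈) , λ { zero → sym l₀ ; (suc i) → l'≗ i }
... | l' , l'∈ , l'≗ | zer = _ , ∈P.∈-concat⁺′ (there (here refl)) (∈P.∈-map⁺ _ l'∈) , λ { zero → sym l₀ ; (suc i) → l'≗ i }
... | l' , l'∈ , l'≗ | pos = _ , ∈P.∈-concat⁺′ (there (there (here refl))) (∈P.∈-map⁺ _ l'∈) , λ { zero → sym l₀ ; (suc i) → l'≗ i }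

∈-restrictedSignedSumList⁻ : ∀ n (a : Fin n → ℤ) → x ∈ restrictedSignedSumList w n a → IsSignedSum n a w x
∈-restrictedSignedSumList⁻ {w = w} n a x∈ with ∈P.∈-map⁻ (signedSum n a) x∈
... | l , l∈ , x≡ = l , proj₂ (∈P.∈-filter⁻ (λ l → weight n l ℕP.≟ w) {xs = signVecs n} l∈) , sym x≡

∈-restrictedSignedSumList⁺ : ∀ n (a : Fin n → ℤ) → IsSignedSum n a w x → x ∈ restrictedSignedSumList w n a
∈-restrictedSignedSumList⁺ {w = w} n a (l , wl , sl) with signVecs-complete n l
... | l' , l'∈ , l'≗ =
  subst (_∈ restrictedSignedSumList w n a) (trans (signedSum-cong n (λ _ → refl) l'≗) sl)
    (∈P.∈-map⁺ (signedSum n a) (∈P.∈-filter⁺ (λ l → weight n l ℕP.≟ w) l'∈ (trans (weight-cong n l'≗) wl)))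

record Distinct (m : ℕ) (P : ℤ → Set) : Set where
  field
    elems   : List ℤ
    unique  : Unique elems
    all     : All P elems
    length≥ : m ≤ length elems

Distinct-map : ∀ {f : ℤ → ℤ} → (∀ {x y} → f x ≡ f y → x ≡ y) → (∀ {x} → P x → R (f x)) →
               Distinct m P → Distinct m R
Distinct-map {f = f} f-inj P⇒R D = record
  { elems   = map f elems
  ; unique  = UniqueP.map⁺ f-inj unique
  ; all     = AllP.map⁺ (All.map P⇒R all)
  ; length≥ = subst (_ ≤_) (sym (ListP.length-map f elems)) length≥
  }
  where open Distinct D

Distinct-weaken : (∀ {x} → P x → R x) → Distinct m P → Distinct m R
Distinct-weaken = Distinct-map id

Distinct-++ : ∀ {m n} → (∀ {x y} → P x → R y → x ≢ y) →
              Distinct m P → Distinct n R → Distinct (m + n) (λ x → P x ⊎ R x)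
Distinct-++ P#R D E = record
  { elems   = D.elems ++ E.elems
  ; unique  = AllPairsP.++⁺ D.unique E.unique (All.map (λ p → All.map (P#R p) E.all) D.all)
  ; all     = AllP.++⁺ (All.map inj₁ D.all) (All.map inj₂ E.all)
  ; length≥ = subst (_ ≤_) (sym (ListP.length-++ D.elems)) (ℕP.+-mono-≤ D.length≥ E.length≥)
  }
  where module D = Distinct D; module E = Distinct E

Distinct-[_] : P x → Distinct 1 P
Distinct-[ p ] = record { elems = _ ∷ [] ; unique = [] ∷ [] ; all = p ∷ [] ; length≥ = ℕP.≤-refl }

unique⊆⇒length≤ : ∀ {xs ys : List ℤ} → Unique xs → (∀ {z} → z ∈ xs → z ∈ ys) → length xs ≤ length ys
unique⊆⇒length≤ {[]}     _            _  = z≤n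
unique⊆⇒length≤ {x ∷ xs} {ys} (x∉xs ∷ u) xs⊆ys with ∈P.∈-∃++ (xs⊆ys (here refl))
... | ys₁ , ys₂ , refl =
  subst (suc (length xs) ≤_) (sym length-ys) (s≤s (unique⊆⇒length≤ u xs⊆ys₁ys₂))
  where
  length-ys : length (ys₁ ++ x ∷ ys₂) ≡ suc (length (ys₁ ++ ys₂))
  length-ys = trans (ListP.length-++ ys₁)
                (trans (ℕP.+-suc (length ys₁) (length ys₂)) (cong suc (sym (ListP.length-++ ys₁))))
  xs⊆ys₁ys₂ : ∀ {z} → z ∈ xs → z ∈ ys₁ ++ ys₂
  xs⊆ys₁ys₂ z∈xs with ∈P.∈-++⁻ ys₁ (xs⊆ys (there z∈xs))
  ... | inj₁ z∈ys₁          = ∈P.∈-++⁺ˡ z∈ys₁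
  ... | inj₂ (here refl)    = ⊥-elim (All.lookup x∉xs z∈xs refl)
  ... | inj₂ (there z∈ys₂) = ∈P.∈-++⁺ʳ ys₁ z∈ys₂

Distinct-deduplicate : ∀ xs → Distinct (length (deduplicate ℤ._≟_ xs)) (_∈ xs)
Distinct-deduplicate xs = record
  { elems   = deduplicate ℤ._≟_ xs
  ; unique  = deduplicate-! ℤ._≟_ xs
  ; all     = All.tabulate (∈P.∈-deduplicate⁻ ℤ._≟_ xs)
  ; length≥ = ℕP.≤-refl
  }

Distinct⇒≤length-deduplicate : ∀ {xs} → Distinct m (_∈ xs) → m ≤ length (deduplicate ℤ._≟_ xs)
Distinct⇒≤length-deduplicate D = ℕP.≤-trans length≥
  (unique⊆⇒length≤ unique (∈P.∈-deduplicate⁺ ℤ._≟_ ∘ All.lookup all))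
  where open Distinct D

module SignedSums (b : ℕ → ℕ) where

  prefix : (n : ℕ) → Fin n → ℤ
  prefix n i = + b (toℕ i)

  -- SignedSum w n x  ⇔  x ∈ w^∧_± {b 0, …, b (n − 1)}
  data SignedSum : ℕ → ℕ → ℤ → Set where
    []   : SignedSum 0 0 (+ 0)
    skip : SignedSum w n x → SignedSum w (suc n) x
    add  : SignedSum w n x → SignedSum (suc w) (suc n) (x ℤ.+ + b n)
    sub  : SignedSum w n x → SignedSum (suc w) (suc n) (x ℤ.- + b n)

  init-prefix : ∀ n → init (prefix (suc n)) ≗ prefix n
  init-prefix n i = cong (+_ ∘ b) (FP.toℕ-inject₁ i)

  last-prefix : ∀ n → last (prefix (suc n)) ≡ + b n
  last-prefix n = cong (+_ ∘ b) (FP.toℕ-fromℕ n)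

  signedSum-prefix : ∀ n (l : Fin (suc n) → Sign) →
    signedSum (suc n) (prefix (suc n)) l ≡ signedSum n (prefix n) (init l) ℤ.+ act (last l) (+ b n)
  signedSum-prefix n l =
    trans (signedSum-init-last n (prefix (suc n)) l)
          (cong₂ ℤ._+_ (signedSum-cong n (init-prefix n) (λ _ → refl)) (cong (act (last l)) (last-prefix n)))

  _∷ʳ⟨_⟩ : SignedSum w n x → (s : Sign) → SignedSum (w + ∣ s ∣ˢ) (suc n) (x ℤ.+ act s (+ b n))
  _∷ʳ⟨_⟩ {w} {n} {x} q neg = subst (λ v → SignedSum v (suc n) (x ℤ.- + b n)) (ℕP.+-comm 1 w) (sub q)
  _∷ʳ⟨_⟩ {w} {n} {x} q zer =
    subst₂ (λ v y → SignedSum v (suc n) y) (sym (ℕP.+-identityʳ w)) (sym (ℤP.+-identityʳ x)) (skip q)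
  _∷ʳ⟨_⟩ {w} {n} {x} q pos = subst (λ v → SignedSum v (suc n) (x ℤ.+ + b n)) (ℕP.+-comm 1 w) (add q)

  fromIsSignedSum : ∀ n → IsSignedSum n (prefix n) w x → SignedSum w n x
  fromIsSignedSum zero    (l , refl , refl) = []
  fromIsSignedSum (suc n) (l , refl , refl) =
    subst₂ (λ v y → SignedSum v (suc n) y) (sym (weight-init-last n l)) (sym (signedSum-prefix n l))
      (fromIsSignedSum n (init l , refl , refl) ∷ʳ⟨ last l ⟩)

  IsSignedSum-∷ʳ : ∀ n s → IsSignedSum n (prefix n) w x →
                   IsSignedSum (suc n) (prefix (suc n)) (w + ∣ s ∣ˢ) (x ℤ.+ act s (+ b n))
  IsSignedSum-∷ʳ n s (l , refl , refl) = l ∷ʳ s ,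
    trans (weight-init-last n (l ∷ʳ s)) (cong₂ _+_ (weight-cong n (init-∷ʳ l s)) (cong ∣_∣ˢ (last-∷ʳ l s))) ,
    trans (signedSum-prefix n (l ∷ʳ s))
          (cong₂ ℤ._+_ (signedSum-cong n (λ _ → refl) (init-∷ʳ l s)) (cong (λ v → act v (+ b n)) (last-∷ʳ l s)))

  toIsSignedSum : SignedSum w n x → IsSignedSum n (prefix n) w x
  toIsSignedSum [] = (λ ()) , refl , refl
  toIsSignedSum {w} {suc n} {x} (skip q) =
    subst₂ (IsSignedSum (suc n) (prefix (suc n))) (ℕP.+-identityʳ w) (ℤP.+-identityʳ x)
      (IsSignedSum-∷ʳ n zer (toIsSignedSum q))
  toIsSignedSum {suc w} {suc n} (add {x = x} q) =
    subst (λ v → IsSignedSum (suc n) (prefix (suc n)) v (x ℤ.+ + b n)) (ℕP.+-comm w 1) (IsSignedSum-∷ʳ n pos (toIsSignedSum q))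
  toIsSignedSum {suc w} {suc n} (sub {x = x} q) =
    subst (λ v → IsSignedSum (suc n) (prefix (suc n)) v (x ℤ.- + b n)) (ℕP.+-comm w 1) (IsSignedSum-∷ʳ n neg (toIsSignedSum q))

  SignedSum-neg : SignedSum w n x → SignedSum w n (- x)
  SignedSum-neg [] = []
  SignedSum-neg (skip q) = skip (SignedSum-neg q)
  SignedSum-neg (add {n = n} {x = x} q) =
    subst (SignedSum _ _) (sym (ℤP.neg-distrib-+ x (+ b n))) (sub (SignedSum-neg q))
  SignedSum-neg (sub {n = n} {x = x} q) =
    subst (SignedSum _ _)
      (sym (trans (ℤP.neg-distrib-+ x (- + b n)) (cong (ℤ._+_ (- x)) (ℤP.neg-involutive (+ b n)))))
      (add (SignedSum-neg q))

module Growth (b : ℕ → ℕ) (b-increasing : ∀ n → b n < b (suc n)) where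
  open SignedSums b

  topSum : ℕ → ℕ → ℕ
  topSum zero    n       = 0
  topSum (suc w) zero    = 0
  topSum (suc w) (suc n) = b n + topSum w n

  topSum-mono : ∀ w n → topSum w n ≤ topSum w (suc n)
  topSum-mono zero    n       = z≤n
  topSum-mono (suc w) zero    = z≤n
  topSum-mono (suc w) (suc n) = ℕP.+-mono-≤ (ℕP.<⇒≤ (b-increasing n)) (topSum-mono w n)

  SignedSum⇒≤topSum : SignedSum w n x → x ℤ.≤ + topSum w n
  SignedSum⇒≤topSum [] = ℤP.≤-refl
  SignedSum⇒≤topSum {w} {suc n} (skip q) = ℤP.≤-trans (SignedSum⇒≤topSum q) (+≤+ (topSum-mono w n))
  SignedSum⇒≤topSum {suc w} {suc n} (add {x = x} q) =
    subst (x ℤ.+ + b n ℤ.≤_) (cong +_ (ℕP.+-comm (topSum w n) (b n)))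
      (ℤP.+-monoˡ-≤ (+ b n) (SignedSum⇒≤topSum q))
  SignedSum⇒≤topSum {suc w} {suc n} (sub {x = x} q) =
    ℤP.≤-trans (ℤP.i-j≤i x (+ b n)) (ℤP.≤-trans (SignedSum⇒≤topSum q) (+≤+ (ℕP.m≤n+m (topSum w n) (b n))))

  SignedSum⇒-topSum≤ : SignedSum w n x → - + topSum w n ℤ.≤ x
  SignedSum⇒-topSum≤ {x = x} q =
    subst (- + _ ℤ.≤_) (ℤP.neg-involutive x) (ℤP.neg-mono-≤ (SignedSum⇒≤topSum (SignedSum-neg q)))

  SignedSum-zero : ∀ n → SignedSum 0 n (+ 0)
  SignedSum-zero zero    = []
  SignedSum-zero (suc n) = skip (SignedSum-zero n)

  SignedSum-topSum : w ≤ n → SignedSum w n (+ topSum w n)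
  SignedSum-topSum {zero}  {n}     _         = SignedSum-zero n
  SignedSum-topSum {suc w} {suc n} (s≤s w≤n) =
    subst (SignedSum (suc w) (suc n)) (cong +_ (ℕP.+-comm (topSum w n) (b n))) (add (SignedSum-topSum w≤n))

  topSum<shift : ∀ w n {y} → + topSum w n ℤ.≤ y → + topSum (suc w) (suc n) ℤ.< y ℤ.+ + b (suc n)
  topSum<shift w n {y} T≤y =
    subst (ℤ._< y ℤ.+ + b (suc n)) (cong +_ (ℕP.+-comm (topSum w n) (b n)))
      (ℤP.+-mono-≤-< T≤y (+<+ (b-increasing n)))

  -- The sums obtained by omitting one of the w + 1 largest of b 0, …, b n from their total.
  largeSums : ∀ w n → w ≤ n →
              Distinct (suc w) (λ y → SignedSum w (suc n) y × + topSum w n ℤ.≤ y)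
  sumsAboveTop : ∀ w n → w ≤ n →
                 Distinct (suc w) (λ z → SignedSum (suc w) (suc (suc n)) z × + topSum (suc w) (suc n) ℤ.< z)

  largeSums zero    n       _         = Distinct-[ SignedSum-zero (suc n) , +≤+ z≤n ]
  largeSums (suc w) (suc n) (s≤s w≤n) =
    Distinct-weaken [ (λ { refl → skip (SignedSum-topSum (s≤s w≤n)) , ℤP.≤-refl })
                    , (λ (q , T<y) → q , ℤP.<⇒≤ T<y) ]
      (Distinct-++ (λ { refl (_ , T<y) → ℤP.<⇒≢ T<y })
        (Distinct-[_] {P = _≡ + topSum (suc w) (suc n)} refl)
        (sumsAboveTop w n w≤n))

  sumsAboveTop w n w≤n =
    Distinct-map (∙-cancelʳ (+ b (suc n)) _ _) (λ (q , T≤y) → add q , topSum<shift w n T≤y)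
      (largeSums w n w≤n)

  extend : ∀ h n → h ≤ n → Distinct m (SignedSum (suc h) (suc n)) →
           Distinct (suc h + suc h + m) (SignedSum (suc h) (suc (suc n)))
  extend {m} h n h≤n D =
    subst (λ k → Distinct k Sum) (sym (ℕP.+-assoc (suc h) (suc h) m))
      (Distinct-weaken [ proj₁ , [ proj₁ , proj₁ ] ]
        (Distinct-++ upper#rest uppers (Distinct-++ lower#middle lowers middle)))
    where
    Sum : ℤ → Set
    Sum = SignedSum (suc h) (suc (suc n))
    B : ℤ
    B = + topSum (suc h) (suc n)

    uppers : Distinct (suc h) (λ z → Sum z × B ℤ.< z)
    uppers = sumsAboveTop h n h≤n

    lowers : Distinct (suc h) (λ z → Sum z × z ℤ.< - B)
    lowers = Distinct-map ℤP.neg-injective (λ (q , B<z) → SignedSum-neg q , ℤP.neg-mono-< B<z) uppers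

    middle : Distinct m (λ z → Sum z × - B ℤ.≤ z × z ℤ.≤ B)
    middle = Distinct-weaken (λ q → skip q , SignedSum⇒-topSum≤ q , SignedSum⇒≤topSum q) D

    lower#middle : ∀ {x y} → Sum x × x ℤ.< - B → Sum y × - B ℤ.≤ y × y ℤ.≤ B → x ≢ y
    lower#middle (_ , x<-B) (_ , -B≤y , _) = ℤP.<⇒≢ (ℤP.<-≤-trans x<-B -B≤y)

    upper#rest : ∀ {x y} → Sum x × B ℤ.< x →
                 (Sum y × y ℤ.< - B) ⊎ (Sum y × - B ℤ.≤ y × y ℤ.≤ B) → x ≢ y
    upper#rest (_ , B<x) (inj₁ (_ , y<-B)) =
      ≢-sym (ℤP.<⇒≢ (ℤP.<-trans y<-B (ℤP.≤-<-trans ℤP.neg-≤-pos B<x)))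
    upper#rest (_ , B<x) (inj₂ (_ , _ , y≤B)) = ≢-sym (ℤP.<⇒≢ (ℤP.≤-<-trans y≤B B<x))

  extend* : ∀ h d → Distinct m (SignedSum (suc h) (suc (suc h))) →
            Distinct (d * (suc h + suc h) + m) (SignedSum (suc h) (suc (d + suc h)))
  extend*     h zero    D = D
  extend* {m} h (suc d) D =
    subst (λ k → Distinct k (SignedSum (suc h) (suc (suc d + suc h))))
      (sym (ℕP.+-assoc (suc h + suc h) (d * (suc h + suc h)) m))
      (extend h (d + suc h) (ℕP.≤-trans (ℕP.n≤1+n h) (ℕP.m≤n+m (suc h) d)) (extend* h d D))

module Extension (K : ℕ) (a : Fin (suc K) → ℕ) (a-increasing : ∀ i j → i F.< j → a i < a j) where

  extension : ℕ → ℕ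
  extension i with i ℕ.≤? K
  ... | yes i≤K = a (fromℕ< (s≤s i≤K))
  ... | no  _   = a (fromℕ K) + i

  extension-toℕ : ∀ i → extension (toℕ i) ≡ a i
  extension-toℕ i with toℕ i ℕ.≤? K
  ... | yes i≤K = cong a (FP.fromℕ<-toℕ i (s≤s i≤K))
  ... | no  i≰K = ⊥-elim (i≰K (ℕ.s≤s⁻¹ (FP.toℕ<n i)))

  extension-increasing : ∀ n → extension n < extension (suc n)
  extension-increasing n with n ℕ.≤? K | suc n ℕ.≤? K
  ... | yes n≤K | yes 1+n≤K =
    a-increasing _ _ (subst₂ _<_ (sym (FP.toℕ-fromℕ< (s≤s n≤K))) (sym (FP.toℕ-fromℕ< (s≤s 1+n≤K))) (ℕP.n<1+n n))
  ... | yes n≤K | no  1+n≰K =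
    subst (_< a (fromℕ K) + suc n) (cong a (sym (FP.toℕ-injective toℕ-n≡K))) (ℕP.m<m+n (a (fromℕ K)) (s≤s z≤n))
    where
    toℕ-n≡K : toℕ (fromℕ< (s≤s n≤K)) ≡ toℕ (fromℕ K)
    toℕ-n≡K = trans (FP.toℕ-fromℕ< (s≤s n≤K))
                (trans (ℕP.≤-antisym n≤K (ℕ.s≤s⁻¹ (ℕP.≰⇒> 1+n≰K))) (sym (FP.toℕ-fromℕ K)))
  ... | no  n≰K | yes 1+n≤K = ⊥-elim (n≰K (ℕP.<⇒≤ 1+n≤K))
  ... | no  _   | no  _     = ℕP.+-monoʳ-< (a (fromℕ K)) (ℕP.n<1+n n)

count-identity : ∀ h d K t → d + h ≡ K →
  2 * h * suc K ∸ h * (h + 1) + 1 + t ≡ d * (h + h) + (h * (h + 1) + 1 + t)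
count-identity h d .(d + h) t refl = begin
  2 * h * suc (d + h) ∸ h * (h + 1) + 1 + t
    ≡⟨ cong (λ n → n ∸ h * (h + 1) + 1 + t) (expand h d) ⟩
  h * (h + 1) + (h * (h + 1) + d * (h + h)) ∸ h * (h + 1) + 1 + t
    ≡⟨ cong (λ n → n + 1 + t) (ℕP.m+n∸m≡n (h * (h + 1)) _) ⟩
  h * (h + 1) + d * (h + h) + 1 + t
    ≡⟨ rearrange (h * (h + 1)) (d * (h + h)) t ⟩
  d * (h + h) + (h * (h + 1) + 1 + t) ∎
  where
  open ≡-Reasoning
  expand : ∀ h d → 2 * h * suc (d + h) ≡ h * (h + 1) + (h * (h + 1) + d * (h + h))
  expand = solve-∀
  rearrange : ∀ x y t → x + y + 1 + t ≡ y + (x + 1 + t)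
  rearrange = solve-∀

lemma2p3 : (h k : ℕ) → 5 ≤ k → 3 ≤ h → (hk : suc h ≤ k)
    → (a : Fin k → ℕ)
    → (∀ (i j : Fin k) → i F.< j → a i < a j)
    → (∀ (i : Fin k) → toℕ i ≡ 0 → a i ≡ 0)
    → (t : ℕ)
    → h * (h + 1) + 1 + t ≤ card-hSignedSumset h (suc h) (λ i → + a (inject≤ i hk))
    → 2 * h * k ∸ h * (h + 1) + 1 + t ≤ card-hSignedSumset h k (λ i → + a i)
lemma2p3 zero       _       _ () _ _ _ _ _ _
lemma2p3 (suc _)    zero    _ _  () _ _ _ _ _
lemma2p3 h@(suc h') (suc K) _ _ hk@(s≤s h≤K) a a-increasing _ t card≥ =
  subst (_≤ card-hSignedSumset h (suc K) (λ i → + a i)) (sym (count-identity h d K t d+h≡K))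
    (ℕP.≤-trans (ℕP.+-monoʳ-≤ (d * (h + h)) card≥) (Distinct⇒≤length-deduplicate sumsOfA))
  where
  open Extension K a a-increasing
  open SignedSums extension
  open Growth extension extension-increasing
  d : ℕ
  d = K ∸ h
  d+h≡K : d + h ≡ K
  d+h≡K = ℕP.m∸n+n≡m h≤K
  aₕ : Fin (suc h) → ℤ
  aₕ i = + a (inject≤ i hk)
  aₕ≗prefix : aₕ ≗ prefix (suc h)
  aₕ≗prefix i = cong +_ (trans (sym (extension-toℕ (inject≤ i hk))) (cong extension (FP.toℕ-inject≤ i hk)))
  bound : ℕ
  bound = d * (h + h) + card-hSignedSumset h (suc h) aₕ
  sumsOfAₕ : Distinct (card-hSignedSumset h (suc h) aₕ) (SignedSum h (suc h))
  sumsOfAₕ = Distinct-weaken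
    (fromIsSignedSum (suc h) ∘ IsSignedSum-cong (suc h) aₕ≗prefix ∘ ∈-restrictedSignedSumList⁻ (suc h) aₕ)
    (Distinct-deduplicate (restrictedSignedSumList h (suc h) aₕ))
  sumsOfA : Distinct bound (_∈ restrictedSignedSumList h (suc K) (λ i → + a i))
  sumsOfA = Distinct-weaken
    (∈-restrictedSignedSumList⁺ (suc K) (λ i → + a i) ∘ IsSignedSum-cong (suc K) (cong +_ ∘ extension-toℕ) ∘ toIsSignedSum)
    (subst (λ n → Distinct bound (SignedSum h (suc n))) d+h≡K (extend* h' d sumsOfAₕ))
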